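{- Let $\mathfrak{g}$ be of type $E_7^{(1)}$ and $s\ge1$. Let $\alpha = \alpha_1+2\alpha_2+2\alpha_3+3\alpha_4+2\alpha_5+\alpha_6 = \Lambda_2-\Lambda_7$. Then the highest weight rigged configurations of $B^{2,s}$ are exactly $\nu(k\ast[\alpha])$, $0\le k\le s$, with all riggings $0$; the one indexed by $k$ has weight $(s-k)\Lambda_2+k\Lambda_7$ and cocharge $k$. Consequently \[ \mathrm{RC}(B^{2,s}) \cong \bigoplus_{k=0}^s \mathrm{RC}(B^{2,s}; (s-k)\Lambda_2 + k\Lambda_7). \]
   Context: Finite type $E_7$ with Bourbaki labeling: edges $1$–$3$, $3$–$4$, $4$–$5$, $5$–$6$, $6$–$7$, $2$–$4$; $I_0=\{1,\dots,7\}$, Cartan matrix $(A_{ab})$, simple roots $\alpha_a$, fundamental weights $\Lambda_a$. Rigged configurations for $B^{r,s}$: a configuration $\nu=(\nu^{(a)})_{a\in I_0}$ is a tuple of partitions, $m_i^{(a)}$ the number of rows of length $i$ in $\nu^{(a)}$. Vacancy numbers: $p_i^{(a)} = \delta_{ar}\min(i,s) - \sum_{b\in I_0}A_{ab}\sum_{j\ge1}\min(i,j)m_j^{(b)}$. A rigged configuration $(\nu,J)$ assigns to each row of $\nu^{(a)}$ of length $i$ an integer rigging $x\le p_i^{(a)}$ (a multiset for rows of equal length); it is highest weight if all riggings are $\ge 0$. Weight: $s\Lambda_r-\sum_a|\nu^{(a)}|\alpha_a$. Cocharge: $\mathrm{cc}(\nu,J)=\frac12\sum_{a,b\in I_0}\sum_{i,j}A_{ab}\min(i,j)m_i^{(a)}m_j^{(b)}+\sum(\text{all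 riggings})$. $\mathrm{RC}(B^{r,s})$ is a $U_q(\mathfrak{g}_0)$-crystal whose highest weight elements are the highest weight rigged configurations, each of weight $\lambda$ generating a component isomorphic to $B(\lambda)$; $\mathrm{RC}(B^{r,s};\lambda)$ is the union of components with highest weight $\lambda$. For $\beta^{(k)}=\sum_a c_a^{(k)}\alpha_a$ with $c_a^{(k)}\in\mathbb{Z}_{\ge0}$, $\nu(\beta^{(1)},\dots,\beta^{(\ell)})$ is the configuration in which $\nu^{(a)}$ has columns of heights $c_a^{(1)},\dots,c_a^{(\ell)}$ (sorted, zeros omitted); $k\ast[\beta]$ is $k$ copies of $\beta$. -}

module Defs where

open import Data.Nat as ℕ using (ℕ; zero; suc)
open import Data.Integer as ℤ using (ℤ; +_; 0ℤ; _/ℕ_)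
open import Data.Fin using (Fin; toℕ; #_)
open import Data.Bool using (Bool; true; false; if_then_else_; _∨_; _∧_)
open import Data.List using (List; []; _∷_; map; foldr; replicate; allFin)
open import Data.List.Relation.Unary.All using (All)
open import Data.List.Relation.Binary.Permutation.Propositional using (_↭_)
open import Data.Product using (_×_; _,_; proj₁; proj₂)
open import Relation.Binary.PropositionalEquality using (_≡_)

-- Index set I₀ = {1,…,7} of E₇, realised as Fin 7: Bourbaki label ℓ ↦ # (ℓ - 1).
I₀ : Set
I₀ = Fin 7

label : I₀ → ℕ
label a = suc (toℕ a)

edgeℕ : ℕ → ℕ → Bool
edgeℕ i j = ((i ℕ.≡ᵇ 1) ∧ (j ℕ.≡ᵇ 3)) ∨ ((i ℕ.≡ᵇ 3) ∧ (j ℕ.≡ᵇ 4))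
          ∨ ((i ℕ.≡ᵇ 4) ∧ (j ℕ.≡ᵇ 5)) ∨ ((i ℕ.≡ᵇ 5) ∧ (j ℕ.≡ᵇ 6))
          ∨ ((i ℕ.≡ᵇ 6) ∧ (j ℕ.≡ᵇ 7)) ∨ ((i ℕ.≡ᵇ 2) ∧ (j ℕ.≡ᵇ 4))

adjacent : I₀ → I₀ → Bool
adjacent a b = edgeℕ (label a) (label b) ∨ edgeℕ (label b) (label a)

A : I₀ → I₀ → ℤ
A a b = if label a ℕ.≡ᵇ label b then + 2
        else (if adjacent a b then ℤ.- (+ 1) else 0ℤ)

δ : I₀ → I₀ → ℤ
δ a b = if label a ℕ.≡ᵇ label b then + 1 else 0ℤ

Σℤ : {X : Set} → List X → (X → ℤ) → ℤ
Σℤ xs f = foldr (λ x acc → f x ℤ.+ acc) 0ℤ xs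

ΣI : (I₀ → ℤ) → ℤ
ΣI f = Σℤ (allFin 7) f

-- A rigged partition: the list of its rows, each row given as
-- (row length i, rigging x).  Order of the list is immaterial
-- (rigged configurations are compared up to permutation, see _≈RC_),
-- which models the multiset of riggings attached to rows of equal length.
Row : Set
Row = ℕ × ℤ

RiggedPartition : Set
RiggedPartition = List Row

RC : Set
RC = I₀ → RiggedPartition

_≈RC_ : RC → RC → Set
ρ ≈RC σ = (a : I₀) → ρ a ↭ σ a

minℤ : ℕ → ℕ → ℤ
minℤ i j = + (ℕ._⊓_ i j)

-- Σ_{j ≥ 1} min(i,j) m_j^{(b)}  =  Σ_{rows of ν^{(b)}} min(i, row length).
Q : ℕ → RiggedPartition → ℤ
Q i ν = Σℤ ν (λ row → minℤ i (proj₁ row))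

vacancy : I₀ → ℕ → RC → I₀ → ℕ → ℤ
vacancy r s ρ a i =
  δ a r ℤ.* minℤ i s ℤ.- ΣI (λ b → A a b ℤ.* Q i (ρ b))

IsRC : I₀ → ℕ → RC → Set
IsRC r s ρ = (a : I₀) →
  All (λ row → (1 ℕ.≤ proj₁ row) × (proj₂ row ℤ.≤ vacancy r s ρ a (proj₁ row))) (ρ a)

IsHWRC : I₀ → ℕ → RC → Set
IsHWRC r s ρ = IsRC r s ρ × ((a : I₀) → All (λ row → 0ℤ ℤ.≤ proj₂ row) (ρ a))

size : RiggedPartition → ℤ
size ν = Σℤ ν (λ row → + proj₁ row)

-- Weights as coordinates in the basis of fundamental weights Λ_b;
-- α_a = Σ_b A_{ab} Λ_b.  weight = sΛ_r − Σ_a |ν^{(a)}| α_a.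
Weight : Set
Weight = I₀ → ℤ

weight : I₀ → ℕ → RC → Weight
weight r s ρ b = (+ s) ℤ.* δ b r ℤ.- ΣI (λ a → size (ρ a) ℤ.* A a b)

-- ½ Σ_{a,b} Σ_{i,j} A_{ab} min(i,j) m_i^{(a)} m_j^{(b)}, written as a sum over pairs of rows.
quadratic : RC → ℤ
quadratic ρ = ΣI (λ a → ΣI (λ b → A a b ℤ.*
                Σℤ (ρ a) (λ row → Σℤ (ρ b) (λ row' → minℤ (proj₁ row) (proj₁ row')))))

riggingSum : RC → ℤ
riggingSum ρ = ΣI (λ a → Σℤ (ρ a) proj₂)

cocharge : RC → ℤ
cocharge ρ = (quadratic ρ /ℕ 2) ℤ.+ riggingSum ρ

-- Roots as coefficient vectors in the simple roots.
Root : Set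
Root = I₀ → ℕ

αE7 : Root
αE7 a = coeff (label a)
  where
  coeff : ℕ → ℕ
  coeff 1 = 1
  coeff 2 = 2
  coeff 3 = 2
  coeff 4 = 3
  coeff 5 = 2
  coeff 6 = 1
  coeff _ = 0

-- ν(k ∗ [β]) with all riggings 0: ν^{(a)} has k columns of height c_a,
-- i.e. c_a rows of length k (empty when k = 0).
νkβ : ℕ → Root → RC
νkβ zero β a = []
νkβ (suc k) β a = replicate (β a) (suc k , 0ℤ)

node2 node7 : I₀
node2 = # 1
node7 = # 6

targetWeight : ℕ → ℕ → Weight
targetWeight s k b = (+ (s ℕ.∸ k)) ℤ.* δ b node2 ℤ.+ (+ k) ℤ.* δ b node7

-- Sum the vacancy numbers p_ℓ⁽ᵃ⁾ over all rows of a rigged configuration ν of B^{2,s}.  Removing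
-- the first column, with height vector h ∈ ℕ⁷, gives p_{ℓ+1}(ν, s) = p_1(ν, s) + p_ℓ(ν′, s − 1) for
-- the remaining configuration ν′, so the total is a sum over the columns of terms
-- h₂ · min(1, s′) − (h , h), where s′ drops by one per column and (h , h) = hᵀAh is the E₇ Cartan
-- form.  On ℕ⁷ one has (h , h) ≥ h₂, with equality only for h = 0 and seven roots: sum-of-squares
-- certificates confine the equality case to a small box, which is searched exhaustively.  For a
-- highest weight configuration the total is ≥ 0, since every rigging is, so each column term
-- vanishes: all riggings and vacancy numbers are 0, and ν has k ≤ s columns, each one of the seven
-- roots.  Pairing the vacancy numbers at the longest rows with α = Λ₂ − Λ₇ then gives
-- |ν⁽⁷⁾| = 2k − |ν⁽²⁾| = 0, and α is the only one of the seven roots that vanishes at node 7, so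
-- ν = ν(k ∗ [α]).  The converse is a direct computation.

module Submission where

open import Defs
open import Data.Bool using (true; false; if_then_else_)
open import Data.Empty using (⊥-elim)
open import Data.Fin using (#_) renaming (zero to fz; suc to fs)
open import Data.Fin.Properties using (all?)
open import Data.Integer as ℤ using (ℤ; +_; -[1+_]; 0ℤ; _+_; _*_; _-_; -_; _≤_; +≤+; _/ℕ_)
import Data.Integer.Properties as ℤ
open import Data.Integer.Tactic.RingSolver using (ring; solve-∀)
open import Data.List using (List; []; _∷_; length; replicate; map; foldr; allFin)
open import Data.List.Membership.Propositional using (_∈_)
open import Data.List.Membership.Propositional.Properties using (∈-allFin)
open import Data.List.Properties using (map-cong; length-replicate; ∷-injective)
open import Data.List.Relation.Binary.Permutation.Propositional using (↭-reflexive)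
open import Data.List.Relation.Unary.All as All using (All; []; _∷_)
open import Data.List.Relation.Unary.All.Properties using (replicate⁺)
open import Data.List.Relation.Unary.Any as Any using (Any; here; there; any?)
open import Data.Nat as ℕ using (ℕ; zero; suc; z≤n; s≤s)
import Data.Nat.DivMod as ℕ
open import Data.Nat.ListAction using (sum)
import Data.Nat.Properties as ℕ
open import Data.Nat.Properties using (allUpTo?)
open import Data.Product using (Σ; _×_; _,_; proj₁; proj₂)
open import Data.Sum using (_⊎_; inj₁; inj₂)
open import Function using (id; _∘′_; case_of_)
open import Relation.Binary.PropositionalEquality
open import Relation.Nullary using (yes; no)
open import Relation.Nullary.Decidable using (Dec; toWitness; _×-dec_; _→-dec_)
open import Tactic.RingSolver.NonReflective ring using (solve; _⊜_; Expr; Κ; _⊕_; _⊗_; ⊝_)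

+-≤-equal : ∀ {i j k l} → i ≤ k → j ≤ l → i + j ≡ k + l → i ≡ k × j ≡ l
+-≤-equal {i} {j} {k} {l} i≤k j≤l sum≡ =
  ℤ.≤-antisym i≤k (reverse i≤k j≤l sum≡) ,
  ℤ.≤-antisym j≤l (reverse j≤l i≤k (trans (ℤ.+-comm j i) (trans sum≡ (ℤ.+-comm k l))))
  where
  reverse : ∀ {i j k l} → i ≤ k → j ≤ l → i + j ≡ k + l → k ≤ i
  reverse {i} {j} {k} {l} _ j≤l sum≡ = begin
    k           ≡⟨ shift k l ⟩
    k + l - l   ≡⟨ cong (_- l) (sym sum≡) ⟩
    i + j - l   ≤⟨ ℤ.+-monoˡ-≤ (- l) (ℤ.+-monoʳ-≤ i j≤l) ⟩
    i + l - l   ≡⟨ sym (shift i l) ⟩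
    i           ∎
    where
    open ℤ.≤-Reasoning
    shift : ∀ x y → x ≡ x + y - y
    shift = solve-∀

+-cancelʳ-≤ : ∀ {i j} k → i + k ≤ j + k → i ≤ j
+-cancelʳ-≤ {i} {j} k i+k≤j+k = begin
  i           ≡⟨ shift i k ⟩
  i + k - k   ≤⟨ ℤ.+-monoˡ-≤ (- k) i+k≤j+k ⟩
  j + k - k   ≡⟨ sym (shift j k) ⟩
  j           ∎
  where
  open ℤ.≤-Reasoning
  shift : ∀ x y → x ≡ x + y - y
  shift = solve-∀

module _ {X : Set} where

  Σℤ-cong : ∀ {xs : List X} {f g} → All (λ x → f x ≡ g x) xs → Σℤ xs f ≡ Σℤ xs g
  Σℤ-cong [] = refl
  Σℤ-cong (e ∷ es) = cong₂ _+_ e (Σℤ-cong es)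

  Σℤ-zero : ∀ (xs : List X) → Σℤ xs (λ _ → 0ℤ) ≡ 0ℤ
  Σℤ-zero [] = refl
  Σℤ-zero (x ∷ xs) = trans (ℤ.+-identityˡ (Σℤ xs (λ _ → 0ℤ))) (Σℤ-zero xs)

  Σℤ-+ : ∀ (xs : List X) f g → Σℤ xs (λ x → f x + g x) ≡ Σℤ xs f + Σℤ xs g
  Σℤ-+ [] f g = refl
  Σℤ-+ (x ∷ xs) f g = trans (cong (_+_ (f x + g x)) (Σℤ-+ xs f g)) (interchange (f x) (g x) (Σℤ xs f) (Σℤ xs g))
    where
    interchange : ∀ a b c d → (a + b) + (c + d) ≡ (a + c) + (b + d)
    interchange = solve-∀

  Σℤ-*ˡ : ∀ (xs : List X) c f → Σℤ xs (λ x → c * f x) ≡ c * Σℤ xs f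
  Σℤ-*ˡ [] c f = sym (ℤ.*-zeroʳ c)
  Σℤ-*ˡ (x ∷ xs) c f = trans (cong (_+_ (c * f x)) (Σℤ-*ˡ xs c f)) (sym (ℤ.*-distribˡ-+ c (f x) (Σℤ xs f)))

  Σℤ-*ʳ : ∀ (xs : List X) f c → Σℤ xs (λ x → f x * c) ≡ Σℤ xs f * c
  Σℤ-*ʳ [] f c = sym (ℤ.*-zeroˡ c)
  Σℤ-*ʳ (x ∷ xs) f c = trans (cong (_+_ (f x * c)) (Σℤ-*ʳ xs f c)) (sym (ℤ.*-distribʳ-+ c (f x) (Σℤ xs f)))

  Σℤ-replicate : ∀ n (x : X) f → Σℤ (replicate n x) f ≡ + n * f x
  Σℤ-replicate zero x f = refl
  Σℤ-replicate (suc n) x f = trans (cong (_+_ (f x)) (Σℤ-replicate n x f)) (sym (ℤ.suc-* (+ n) (f x)))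

  Σℤ-nonneg : ∀ {xs : List X} {f} → All (λ x → 0ℤ ≤ f x) xs → 0ℤ ≤ Σℤ xs f
  Σℤ-nonneg [] = ℤ.≤-refl
  Σℤ-nonneg (p ∷ ps) = ℤ.+-mono-≤ p (Σℤ-nonneg ps)

  Σℤ-nonneg-zero : ∀ {xs : List X} {f} → All (λ x → 0ℤ ≤ f x) xs → Σℤ xs f ≡ 0ℤ → All (λ x → f x ≡ 0ℤ) xs
  Σℤ-nonneg-zero [] _ = []
  Σℤ-nonneg-zero (0≤fx ∷ 0≤fxs) sum≡0 =
    let fx≡0 , rest≡0 = +-≤-equal 0≤fx (Σℤ-nonneg 0≤fxs) (sym sum≡0)
    in sym fx≡0 ∷ Σℤ-nonneg-zero 0≤fxs (sym rest≡0)

  pos-sum : ∀ (xs : List X) (f : X → ℕ) → + sum (map f xs) ≡ Σℤ xs (λ x → + f x)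
  pos-sum [] f = refl
  pos-sum (x ∷ xs) f = trans (ℤ.pos-+ (f x) (sum (map f xs))) (cong (λ t → + f x + t) (pos-sum xs f))

ΣI-cong : ∀ {f g : I₀ → ℤ} → (∀ a → f a ≡ g a) → ΣI f ≡ ΣI g
ΣI-cong e = Σℤ-cong {xs = allFin 7} (All.tabulate (λ {a} _ → e a))

ΣI-zero : ∀ {f : I₀ → ℤ} → (∀ a → f a ≡ 0ℤ) → ΣI f ≡ 0ℤ
ΣI-zero f≡0 = trans (ΣI-cong f≡0) (Σℤ-zero (allFin 7))

*-vanishing : ∀ n {x} → (1 ℕ.≤ n → x ≡ 0ℤ) → + n * x ≡ 0ℤ
*-vanishing zero _ = refl
*-vanishing (suc n) {x} x≡0 = trans (cong (+ suc n *_) (x≡0 (s≤s z≤n))) (ℤ.*-zeroʳ (+ suc n))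

length≡0⇒≡[] : ∀ {X : Set} (xs : List X) → length xs ≡ 0 → xs ≡ []
length≡0⇒≡[] [] _ = refl

All-nonempty⇒Any : ∀ {X : Set} {P : X → Set} {xs} → All P xs → 1 ℕ.≤ length xs → Any P xs
All-nonempty⇒Any (px ∷ _) _ = here px

maxOver : {X : Set} → (X → ℕ) → List X → ℕ
maxOver f = foldr (λ x m → f x ℕ.⊔ m) 0

≤-maxOver : {X : Set} (f : X → ℕ) {x : X} (xs : List X) → x ∈ xs → f x ℕ.≤ maxOver f xs
≤-maxOver f (y ∷ ys) (here refl) = ℕ.m≤m⊔n (f y) (maxOver f ys)
≤-maxOver f (y ∷ ys) (there x∈ys) = ℕ.≤-trans (≤-maxOver f ys x∈ys) (ℕ.m≤n⊔m (f y) (maxOver f ys))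

square≤⇒≤ : ∀ k c b y → k ℕ.* (y ℕ.* y) ℕ.≤ c → c ℕ.< k ℕ.* (suc b ℕ.* suc b) → y ℕ.≤ b
square≤⇒≤ k c b y ky²≤c c<k[1+b]² with y ℕ.≤? b
... | yes y≤b = y≤b
... | no y≰b = ⊥-elim (ℕ.<⇒≱ c<k[1+b]² (ℕ.≤-trans (ℕ.*-monoʳ-≤ k (ℕ.*-mono-≤ b<y b<y)) ky²≤c))
  where
  b<y : b ℕ.< y
  b<y = ℕ.≰⇒> y≰b

square≤linear⇒≤ : ∀ k d b y → k ℕ.* (y ℕ.* y) ℕ.≤ d ℕ.* y → d ℕ.< k ℕ.* suc b → y ℕ.≤ b
square≤linear⇒≤ k d b zero _ _ = z≤n
square≤linear⇒≤ k d b y@(suc _) ky²≤dy d<k[1+b] with y ℕ.≤? b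
... | yes y≤b = y≤b
... | no y≰b = ⊥-elim (ℕ.<⇒≱ d<k[1+b] (ℕ.≤-trans (ℕ.*-monoʳ-≤ k (ℕ.≰⇒> y≰b)) ky≤d))
  where
  ky≤d : k ℕ.* y ℕ.≤ d
  ky≤d = ℕ.*-cancelʳ-≤ (k ℕ.* y) d y (subst (ℕ._≤ d ℕ.* y) (sym (ℕ.*-assoc k y y)) ky²≤dy)

-- The E₇ root lattice

coords : {X : Set} → X → X → X → X → X → X → X → I₀ → X
coords x₁ x₂ x₃ x₄ x₅ x₆ x₇ fz = x₁
coords x₁ x₂ x₃ x₄ x₅ x₆ x₇ (fs fz) = x₂
coords x₁ x₂ x₃ x₄ x₅ x₆ x₇ (fs (fs fz)) = x₃
coords x₁ x₂ x₃ x₄ x₅ x₆ x₇ (fs (fs (fs fz))) = x₄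
coords x₁ x₂ x₃ x₄ x₅ x₆ x₇ (fs (fs (fs (fs fz)))) = x₅
coords x₁ x₂ x₃ x₄ x₅ x₆ x₇ (fs (fs (fs (fs (fs fz))))) = x₆
coords x₁ x₂ x₃ x₄ x₅ x₆ x₇ (fs (fs (fs (fs (fs (fs fz)))))) = x₇

coords-η : {X : Set} (x : I₀ → X) → coords (x (# 0)) (x (# 1)) (x (# 2)) (x (# 3)) (x (# 4)) (x (# 5)) (x (# 6)) ≗ x
coords-η x fz = refl
coords-η x (fs fz) = refl
coords-η x (fs (fs fz)) = refl
coords-η x (fs (fs (fs fz))) = refl
coords-η x (fs (fs (fs (fs fz)))) = refl
coords-η x (fs (fs (fs (fs (fs fz))))) = refl
coords-η x (fs (fs (fs (fs (fs (fs fz)))))) = refl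

cartanForm : (I₀ → ℤ) → ℤ
cartanForm x = ΣI (λ a → x a * ΣI (λ b → A a b * x b))

normSq : Root → ℤ
normSq h = cartanForm (λ a → + h a)

edges : List (I₀ × I₀)
edges = (# 0 , # 2) ∷ (# 2 , # 3) ∷ (# 3 , # 4) ∷ (# 4 , # 5) ∷ (# 5 , # 6) ∷ (# 1 , # 3) ∷ []

squareSum edgeSum : (I₀ → ℤ) → ℤ
squareSum x = ΣI (λ a → x a * x a)
edgeSum x = Σℤ edges (λ e → x (proj₁ e) * x (proj₂ e))

linear : (I₀ → ℤ) → (I₀ → ℤ) → ℤ
linear ℓ x = ΣI (λ a → ℓ a * x a)

weightedSquares : List (ℕ × (I₀ → ℤ)) → (I₀ → ℤ) → ℤ
weightedSquares ws x = Σℤ ws (λ w → + proj₁ w * (linear (proj₂ w) x * linear (proj₂ w) x))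

-- The same polynomials as ring-solver expressions; ⟦_⟧ of each is definitionally the ℤ version,
-- so `solve` proves identities stated in terms of the latter.
module Syntax {n : ℕ} where

  Σₑ : {X : Set} → List X → (X → Expr ℤ n) → Expr ℤ n
  Σₑ xs f = foldr (λ x acc → f x ⊕ acc) (Κ 0ℤ) xs

  cartanFormₑ squareSumₑ edgeSumₑ : (I₀ → Expr ℤ n) → Expr ℤ n
  cartanFormₑ x = Σₑ (allFin 7) (λ a → x a ⊗ Σₑ (allFin 7) (λ b → Κ (A a b) ⊗ x b))
  squareSumₑ x = Σₑ (allFin 7) (λ a → x a ⊗ x a)
  edgeSumₑ x = Σₑ edges (λ e → x (proj₁ e) ⊗ x (proj₂ e))

  linearₑ : (I₀ → ℤ) → (I₀ → Expr ℤ n) → Expr ℤ n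
  linearₑ ℓ x = Σₑ (allFin 7) (λ a → Κ (ℓ a) ⊗ x a)

  weightedSquaresₑ : List (ℕ × (I₀ → ℤ)) → (I₀ → Expr ℤ n) → Expr ℤ n
  weightedSquaresₑ ws x = Σₑ ws (λ w → Κ (+ proj₁ w) ⊗ (linearₑ (proj₂ w) x ⊗ linearₑ (proj₂ w) x))

open Syntax

cartanForm-expand : ∀ x₁ x₂ x₃ x₄ x₅ x₆ x₇ → let x = coords x₁ x₂ x₃ x₄ x₅ x₆ x₇ in
                    cartanForm x + + 2 * edgeSum x ≡ + 2 * squareSum x
cartanForm-expand = solve 7 (λ x₁ x₂ x₃ x₄ x₅ x₆ x₇ → let x = coords x₁ x₂ x₃ x₄ x₅ x₆ x₇ in
                      cartanFormₑ x ⊕ Κ (+ 2) ⊗ edgeSumₑ x ⊜ Κ (+ 2) ⊗ squareSumₑ x) refl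

weightedSquare-nonneg : ∀ w y → 0ℤ ≤ + w * (y * y)
weightedSquare-nonneg w (+ n) rewrite sym (ℤ.pos-* n n) | sym (ℤ.pos-* w (n ℕ.* n)) = +≤+ z≤n
weightedSquare-nonneg w -[1+ n ] rewrite sym (ℤ.pos-* w (suc n ℕ.* suc n)) = +≤+ z≤n

weightedSquares-nonneg : ∀ ws x → 0ℤ ≤ weightedSquares ws x
weightedSquares-nonneg ws x = Σℤ-nonneg {xs = ws} (All.tabulate (λ {w} _ → weightedSquare-nonneg (proj₁ w) (linear (proj₂ w) x)))

-- A sum-of-squares proof of coefficient · xᵢ² ≤ scale · (x , x); by Cauchy–Schwarz for the Cartan
-- form the best possible ratio scale / coefficient is (A⁻¹)ᵢᵢ.
Certifies : I₀ → ℕ → ℕ → List (ℕ × (I₀ → ℤ)) → Set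
Certifies i scale coefficient ws = ∀ x₁ x₂ x₃ x₄ x₅ x₆ x₇ → let x = coords x₁ x₂ x₃ x₄ x₅ x₆ x₇ in
  + scale * cartanForm x ≡ weightedSquares ws x + + coefficient * (x i * x i)

certificateₑ : ∀ {n} → I₀ → ℕ → ℕ → List (ℕ × (I₀ → ℤ)) → (I₀ → Expr ℤ n) → Expr ℤ n × Expr ℤ n
certificateₑ i scale coefficient ws x = Κ (+ scale) ⊗ cartanFormₑ x ⊜ (weightedSquaresₑ ws x ⊕ Κ (+ coefficient) ⊗ (x i ⊗ x i))

record CoordinateBound (i : I₀) : Set where
  field
    scale coefficient : ℕ
    squares : List (ℕ × (I₀ → ℤ))
    certificate : Certifies i scale coefficient squares

  bound : ∀ h c → normSq h ≤ + c → coefficient ℕ.* (h i ℕ.* h i) ℕ.≤ scale ℕ.* c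
  bound h c q≤c = ℤ.drop‿+≤+ (begin
    + (coefficient ℕ.* (h i ℕ.* h i))
      ≡⟨ trans (ℤ.pos-* coefficient _) (cong (+ coefficient *_) (ℤ.pos-* (h i) (h i))) ⟩
    + coefficient * (+ h i * + h i)
      ≡⟨ cong (λ y → + coefficient * (y * y)) (sym (coords-η x i)) ⟩
    + coefficient * (x′ i * x′ i)
      ≡⟨ sym (ℤ.+-identityˡ _) ⟩
    0ℤ + + coefficient * (x′ i * x′ i)
      ≤⟨ ℤ.+-monoˡ-≤ _ (weightedSquares-nonneg squares x′) ⟩
    weightedSquares squares x′ + + coefficient * (x′ i * x′ i)
      ≡⟨ sym (certificate (x (# 0)) (x (# 1)) (x (# 2)) (x (# 3)) (x (# 4)) (x (# 5)) (x (# 6))) ⟩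
    + scale * normSq h
      ≤⟨ ℤ.*-monoˡ-≤-nonNeg (+ scale) q≤c ⟩
    + scale * + c
      ≡⟨ sym (ℤ.pos-* scale c) ⟩
    + (scale ℕ.* c) ∎)
    where
    open ℤ.≤-Reasoning
    x x′ : I₀ → ℤ
    x a = + h a
    x′ = coords (x (# 0)) (x (# 1)) (x (# 2)) (x (# 3)) (x (# 4)) (x (# 5)) (x (# 6))

coordinateBound : ∀ i → CoordinateBound i
coordinateBound fz = record
  { scale = 4 ; coefficient = 2 ; squares = squares
  ; certificate = solve 7 (λ x₁ x₂ x₃ x₄ x₅ x₆ x₇ → certificateₑ fz 4 2 squares (coords x₁ x₂ x₃ x₄ x₅ x₆ x₇)) refl }
  where
  squares : List (ℕ × (I₀ → ℤ))
  squares = (2 , coords 0ℤ (+ 2) 0ℤ (- + 1) 0ℤ 0ℤ 0ℤ)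
    ∷ (2 , coords (- + 1) 0ℤ (+ 2) (- + 1) 0ℤ 0ℤ 0ℤ)
    ∷ (1 , coords (- + 1) 0ℤ 0ℤ (+ 2) (- + 2) 0ℤ 0ℤ)
    ∷ (1 , coords (- + 1) 0ℤ 0ℤ 0ℤ (+ 2) (- + 2) 0ℤ)
    ∷ (1 , coords (- + 1) 0ℤ 0ℤ 0ℤ 0ℤ (+ 2) (- + 2))
    ∷ (1 , coords (- + 1) 0ℤ 0ℤ 0ℤ 0ℤ 0ℤ (+ 2))
    ∷ []
coordinateBound (fs fz) = record
  { scale = 420 ; coefficient = 120 ; squares = squares
  ; certificate = solve 7 (λ x₁ x₂ x₃ x₄ x₅ x₆ x₇ → certificateₑ (fs fz) 420 120 squares (coords x₁ x₂ x₃ x₄ x₅ x₆ x₇)) refl }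
  where
  squares : List (ℕ × (I₀ → ℤ))
  squares = (210 , coords (+ 2) 0ℤ (- + 1) 0ℤ 0ℤ 0ℤ 0ℤ)
    ∷ (70 , coords 0ℤ 0ℤ (+ 3) (- + 2) 0ℤ 0ℤ 0ℤ)
    ∷ (35 , coords 0ℤ (- + 3) 0ℤ (+ 4) (- + 3) 0ℤ 0ℤ)
    ∷ (21 , coords 0ℤ (- + 3) 0ℤ 0ℤ (+ 5) (- + 4) 0ℤ)
    ∷ (14 , coords 0ℤ (- + 3) 0ℤ 0ℤ 0ℤ (+ 6) (- + 5))
    ∷ (10 , coords 0ℤ (- + 3) 0ℤ 0ℤ 0ℤ 0ℤ (+ 7))
    ∷ []
coordinateBound (fs (fs fz)) = record
  { scale = 60 ; coefficient = 10 ; squares = squares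
  ; certificate = solve 7 (λ x₁ x₂ x₃ x₄ x₅ x₆ x₇ → certificateₑ (fs (fs fz)) 60 10 squares (coords x₁ x₂ x₃ x₄ x₅ x₆ x₇)) refl }
  where
  squares : List (ℕ × (I₀ → ℤ))
  squares = (30 , coords (+ 2) 0ℤ (- + 1) 0ℤ 0ℤ 0ℤ 0ℤ)
    ∷ (30 , coords 0ℤ (+ 2) 0ℤ (- + 1) 0ℤ 0ℤ 0ℤ)
    ∷ (10 , coords 0ℤ 0ℤ (- + 2) (+ 3) (- + 2) 0ℤ 0ℤ)
    ∷ (5 , coords 0ℤ 0ℤ (- + 2) 0ℤ (+ 4) (- + 3) 0ℤ)
    ∷ (3 , coords 0ℤ 0ℤ (- + 2) 0ℤ 0ℤ (+ 5) (- + 4))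
    ∷ (8 , coords 0ℤ 0ℤ (- + 1) 0ℤ 0ℤ 0ℤ (+ 3))
    ∷ []
coordinateBound (fs (fs (fs fz))) = record
  { scale = 12 ; coefficient = 1 ; squares = squares
  ; certificate = solve 7 (λ x₁ x₂ x₃ x₄ x₅ x₆ x₇ → certificateₑ (fs (fs (fs fz))) 12 1 squares (coords x₁ x₂ x₃ x₄ x₅ x₆ x₇)) refl }
  where
  squares : List (ℕ × (I₀ → ℤ))
  squares = (6 , coords (+ 2) 0ℤ (- + 1) 0ℤ 0ℤ 0ℤ 0ℤ)
    ∷ (6 , coords 0ℤ (+ 2) 0ℤ (- + 1) 0ℤ 0ℤ 0ℤ)
    ∷ (2 , coords 0ℤ 0ℤ (+ 3) (- + 2) 0ℤ 0ℤ 0ℤ)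
    ∷ (6 , coords 0ℤ 0ℤ 0ℤ (- + 1) (+ 2) (- + 1) 0ℤ)
    ∷ (2 , coords 0ℤ 0ℤ 0ℤ (- + 1) 0ℤ (+ 3) (- + 2))
    ∷ (1 , coords 0ℤ 0ℤ 0ℤ (- + 1) 0ℤ 0ℤ (+ 4))
    ∷ []
coordinateBound (fs (fs (fs (fs fz)))) = record
  { scale = 30 ; coefficient = 4 ; squares = squares
  ; certificate = solve 7 (λ x₁ x₂ x₃ x₄ x₅ x₆ x₇ → certificateₑ (fs (fs (fs (fs fz)))) 30 4 squares (coords x₁ x₂ x₃ x₄ x₅ x₆ x₇)) refl }
  where
  squares : List (ℕ × (I₀ → ℤ))
  squares = (15 , coords (+ 2) 0ℤ (- + 1) 0ℤ 0ℤ 0ℤ 0ℤ)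
    ∷ (15 , coords 0ℤ (+ 2) 0ℤ (- + 1) 0ℤ 0ℤ 0ℤ)
    ∷ (5 , coords 0ℤ 0ℤ (+ 3) (- + 2) 0ℤ 0ℤ 0ℤ)
    ∷ (1 , coords 0ℤ 0ℤ 0ℤ (+ 5) (- + 6) 0ℤ 0ℤ)
    ∷ (15 , coords 0ℤ 0ℤ 0ℤ 0ℤ (- + 1) (+ 2) (- + 1))
    ∷ (5 , coords 0ℤ 0ℤ 0ℤ 0ℤ (- + 1) 0ℤ (+ 3))
    ∷ []
coordinateBound (fs (fs (fs (fs (fs fz))))) = record
  { scale = 60 ; coefficient = 15 ; squares = squares
  ; certificate = solve 7 (λ x₁ x₂ x₃ x₄ x₅ x₆ x₇ → certificateₑ (fs (fs (fs (fs (fs fz))))) 60 15 squares (coords x₁ x₂ x₃ x₄ x₅ x₆ x₇)) refl }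
  where
  squares : List (ℕ × (I₀ → ℤ))
  squares = (30 , coords (+ 2) 0ℤ (- + 1) 0ℤ 0ℤ 0ℤ 0ℤ)
    ∷ (30 , coords 0ℤ (+ 2) 0ℤ (- + 1) 0ℤ 0ℤ 0ℤ)
    ∷ (10 , coords 0ℤ 0ℤ (+ 3) (- + 2) 0ℤ 0ℤ 0ℤ)
    ∷ (2 , coords 0ℤ 0ℤ 0ℤ (+ 5) (- + 6) 0ℤ 0ℤ)
    ∷ (3 , coords 0ℤ 0ℤ 0ℤ 0ℤ (+ 4) (- + 5) 0ℤ)
    ∷ (30 , coords 0ℤ 0ℤ 0ℤ 0ℤ 0ℤ (- + 1) (+ 2))
    ∷ []
coordinateBound (fs (fs (fs (fs (fs (fs fz)))))) = record
  { scale = 60 ; coefficient = 40 ; squares = squares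
  ; certificate = solve 7 (λ x₁ x₂ x₃ x₄ x₅ x₆ x₇ → certificateₑ (fs (fs (fs (fs (fs (fs fz)))))) 60 40 squares (coords x₁ x₂ x₃ x₄ x₅ x₆ x₇)) refl }
  where
  squares : List (ℕ × (I₀ → ℤ))
  squares = (30 , coords (+ 2) 0ℤ (- + 1) 0ℤ 0ℤ 0ℤ 0ℤ)
    ∷ (30 , coords 0ℤ (+ 2) 0ℤ (- + 1) 0ℤ 0ℤ 0ℤ)
    ∷ (10 , coords 0ℤ 0ℤ (+ 3) (- + 2) 0ℤ 0ℤ 0ℤ)
    ∷ (2 , coords 0ℤ 0ℤ 0ℤ (+ 5) (- + 6) 0ℤ 0ℤ)
    ∷ (3 , coords 0ℤ 0ℤ 0ℤ 0ℤ (+ 4) (- + 5) 0ℤ)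
    ∷ (5 , coords 0ℤ 0ℤ 0ℤ 0ℤ 0ℤ (+ 3) (- + 4))
    ∷ []

squareSumℕ edgeSumℕ : Root → ℕ
squareSumℕ h = sum (map (λ a → h a ℕ.* h a) (allFin 7))
edgeSumℕ h = sum (map (λ e → h (proj₁ e) ℕ.* h (proj₂ e)) edges)

normSq-expand : ∀ h → normSq h + + (2 ℕ.* edgeSumℕ h) ≡ + (2 ℕ.* squareSumℕ h)
normSq-expand h = begin
  normSq h + + (2 ℕ.* edgeSumℕ h)   ≡⟨ cong (_+_ (normSq h)) (cast edges proj₁ proj₂) ⟩
  normSq h + + 2 * edgeSum x         ≡⟨ cartanForm-expand (x (# 0)) (x (# 1)) (x (# 2)) (x (# 3)) (x (# 4)) (x (# 5)) (x (# 6)) ⟩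
  + 2 * squareSum x                  ≡⟨ sym (cast (allFin 7) id id) ⟩
  + (2 ℕ.* squareSumℕ h)             ∎
  where
  open ≡-Reasoning
  x : I₀ → ℤ
  x a = + h a
  cast : {X : Set} (xs : List X) (i j : X → I₀) →
         + (2 ℕ.* sum (map (λ y → h (i y) ℕ.* h (j y)) xs)) ≡ + 2 * Σℤ xs (λ y → x (i y) * x (j y))
  cast {X} xs i j = trans (ℤ.pos-* 2 (sum (map f xs))) (cong (+ 2 *_) (trans (pos-sum xs f)
                  (Σℤ-cong {xs = xs} (All.tabulate (λ {y} _ → ℤ.pos-* (h (i y)) (h (j y)))))))
    where
    f : X → ℕ
    f y = h (i y) ℕ.* h (j y)

-- The solutions of (h , h) ≤ h₂ in ℕ⁷: zero and the seven positive roots with α₂-coefficient 2.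
nonzeroTightColumns tightColumns : List Root
nonzeroTightColumns =
  coords 1 2 2 3 2 1 0 ∷ coords 1 2 2 3 2 1 1 ∷ coords 1 2 2 3 2 2 1 ∷ coords 1 2 2 3 3 2 1 ∷
  coords 1 2 2 4 3 2 1 ∷ coords 1 2 3 4 3 2 1 ∷ coords 2 2 3 4 3 2 1 ∷ []
tightColumns = (λ _ → 0) ∷ nonzeroTightColumns

-- `normSq≥h₂` and `normSq-tight` below for a single h, in a subtraction-free ℕ form that is
-- decided by evaluation.
NormBound : Root → Set
NormBound h = h node2 ℕ.+ 2 ℕ.* edgeSumℕ h ℕ.≤ 2 ℕ.* squareSumℕ h
            × (2 ℕ.* squareSumℕ h ℕ.≤ h node2 ℕ.+ 2 ℕ.* edgeSumℕ h → Any (h ≗_) tightColumns)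

normBound? : ∀ h → Dec (NormBound h)
normBound? h = (_ ℕ.≤? _) ×-dec ((_ ℕ.≤? _) →-dec any? (λ g → all? (λ a → h a ℕ.≟ g a)) tightColumns)

-- The box that `coordinateBound` confines any h with (h , h) ≤ h₂ to.
normBound-box : ∀ {c₁} → c₁ ℕ.< 3 → ∀ {c₂} → c₂ ℕ.< 4 → ∀ {c₃} → c₃ ℕ.< 5 → ∀ {c₄} → c₄ ℕ.< 7 →
                ∀ {c₅} → c₅ ℕ.< 5 → ∀ {c₆} → c₆ ℕ.< 4 → ∀ {c₇} → c₇ ℕ.< 3 → NormBound (coords c₁ c₂ c₃ c₄ c₅ c₆ c₇)
normBound-box = toWitness {a? = allUpTo? (λ c₁ → allUpTo? (λ c₂ → allUpTo? (λ c₃ → allUpTo? (λ c₄ →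
  allUpTo? (λ c₅ → allUpTo? (λ c₆ → allUpTo? (λ c₇ → normBound? (coords c₁ c₂ c₃ c₄ c₅ c₆ c₇)) 3) 4) 5) 7) 5) 4) 3} _

productSum-cong : {X : Set} {h g : Root} → h ≗ g → (i j : X → I₀) (xs : List X) →
                  sum (map (λ y → h (i y) ℕ.* h (j y)) xs) ≡ sum (map (λ y → g (i y) ℕ.* g (j y)) xs)
productSum-cong h≗g i j xs = cong sum (map-cong (λ y → cong₂ ℕ._*_ (h≗g (i y)) (h≗g (j y))) xs)

NormBound-resp : ∀ {h g} → h ≗ g → NormBound g → NormBound h
NormBound-resp {h} {g} h≗g (lower , tight) =
  subst₂ ℕ._≤_ (sym lhs≡) (sym rhs≡) lower ,
  λ rhs≤lhs → Any.map (λ g≗c a → trans (h≗g a) (g≗c a)) (tight (subst₂ ℕ._≤_ rhs≡ lhs≡ rhs≤lhs))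
  where
  lhs≡ : h node2 ℕ.+ 2 ℕ.* edgeSumℕ h ≡ g node2 ℕ.+ 2 ℕ.* edgeSumℕ g
  lhs≡ = cong₂ (λ u v → u ℕ.+ 2 ℕ.* v) (h≗g node2) (productSum-cong h≗g proj₁ proj₂ edges)
  rhs≡ : 2 ℕ.* squareSumℕ h ≡ 2 ℕ.* squareSumℕ g
  rhs≡ = cong (2 ℕ.*_) (productSum-cong h≗g id id (allFin 7))

normSq-bounded : ∀ h → normSq h ≤ + h node2 → NormBound h
normSq-bounded h q≤h₂ = NormBound-resp (λ a → sym (coords-η h a))
  (normBound-box (s≤s (within (# 0) 2 (ℕ.≤ᵇ⇒≤ _ _ _))) (s≤s h₂≤3) (s≤s (within (# 2) 4 (ℕ.≤ᵇ⇒≤ _ _ _)))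
                 (s≤s (within (# 3) 6 (ℕ.≤ᵇ⇒≤ _ _ _))) (s≤s (within (# 4) 4 (ℕ.≤ᵇ⇒≤ _ _ _)))
                 (s≤s (within (# 5) 3 (ℕ.≤ᵇ⇒≤ _ _ _))) (s≤s (within (# 6) 2 (ℕ.≤ᵇ⇒≤ _ _ _))))
  where
  module Bound i = CoordinateBound (coordinateBound i)
  h₂≤3 : h node2 ℕ.≤ 3
  h₂≤3 = square≤linear⇒≤ 120 420 3 (h node2) (Bound.bound node2 h (h node2) q≤h₂) (ℕ.≤ᵇ⇒≤ _ _ _)
  within : ∀ i b → Bound.scale i ℕ.* 3 ℕ.< Bound.coefficient i ℕ.* (suc b ℕ.* suc b) → h i ℕ.≤ b
  within i b = square≤⇒≤ (Bound.coefficient i) (Bound.scale i ℕ.* 3) b (h i)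
                 (Bound.bound i h 3 (ℤ.≤-trans q≤h₂ (+≤+ h₂≤3)))

normSq≥h₂ : ∀ h → + h node2 ≤ normSq h
normSq≥h₂ h with normSq h ℤ.≤? + h node2
... | no q≰h₂ = ℤ.<⇒≤ (ℤ.≰⇒> q≰h₂)
... | yes q≤h₂ = +-cancelʳ-≤ (+ (2 ℕ.* edgeSumℕ h)) (begin
  + h node2 + + (2 ℕ.* edgeSumℕ h)  ≡⟨ sym (ℤ.pos-+ (h node2) _) ⟩
  + (h node2 ℕ.+ 2 ℕ.* edgeSumℕ h)  ≤⟨ +≤+ (proj₁ (normSq-bounded h q≤h₂)) ⟩
  + (2 ℕ.* squareSumℕ h)            ≡⟨ sym (normSq-expand h) ⟩
  normSq h + + (2 ℕ.* edgeSumℕ h)   ∎)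
  where open ℤ.≤-Reasoning

normSq-tight : ∀ h → normSq h ≤ + h node2 → Any (h ≗_) tightColumns
normSq-tight h q≤h₂ = proj₂ (normSq-bounded h q≤h₂) (ℤ.drop‿+≤+ (begin
  + (2 ℕ.* squareSumℕ h)            ≡⟨ sym (normSq-expand h) ⟩
  normSq h + + (2 ℕ.* edgeSumℕ h)   ≤⟨ ℤ.+-monoˡ-≤ _ q≤h₂ ⟩
  + h node2 + + (2 ℕ.* edgeSumℕ h)  ≡⟨ sym (ℤ.pos-+ (h node2) _) ⟩
  + (h node2 ℕ.+ 2 ℕ.* edgeSumℕ h)  ∎))
  where open ℤ.≤-Reasoning

NonzeroTight : Root → Set
NonzeroTight h = Any (h ≗_) nonzeroTightColumns

module _ {P : Root → Set} (P-resp : ∀ {h g} → h ≗ g → P g → P h) where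

  NonzeroTight⇒ : All P nonzeroTightColumns → ∀ {h} → NonzeroTight h → P h
  NonzeroTight⇒ all-P tight = let P-g , h≗g = All.lookupAny all-P tight in P-resp h≗g P-g

nonzeroTight-node2 : ∀ {h} → NonzeroTight h → h node2 ≡ 2
nonzeroTight-node2 = NonzeroTight⇒ (λ h≗g g₂≡2 → trans (h≗g node2) g₂≡2)
  (toWitness {a? = All.all? (λ g → g node2 ℕ.≟ 2) nonzeroTightColumns} _)

nonzeroTight-≥α : ∀ {h} → NonzeroTight h → ∀ a → αE7 a ℕ.≤ h a
nonzeroTight-≥α = NonzeroTight⇒ (λ h≗g α≤g a → subst (αE7 a ℕ.≤_) (sym (h≗g a)) (α≤g a))
  (toWitness {a? = All.all? (λ g → all? (λ a → αE7 a ℕ.≤? g a)) nonzeroTightColumns} _)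

nonzeroTight-node7 : ∀ {h} → NonzeroTight h → h node7 ≡ 0 → h ≗ αE7
nonzeroTight-node7 = NonzeroTight⇒ (λ h≗g g₇≡0⇒g≗α h₇≡0 a → trans (h≗g a) (g₇≡0⇒g≗α (trans (sym (h≗g node7)) h₇≡0) a))
  (toWitness {a? = All.all? (λ g → (g node7 ℕ.≟ 0) →-dec all? (λ a → g a ℕ.≟ αE7 a)) nonzeroTightColumns} _)

columnExcess : ℕ → Root → ℤ
columnExcess s h = + h node2 * minℤ 1 s - normSq h

columnExcess-nonpos : ∀ s h → columnExcess s h ≤ 0ℤ
columnExcess-nonpos zero h = ℤ.i≤j⇒i-j≤0 (subst (_≤ normSq h) (sym (ℤ.*-zeroʳ (+ h node2))) (ℤ.≤-trans (+≤+ z≤n) (normSq≥h₂ h)))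
columnExcess-nonpos (suc s) h = ℤ.i≤j⇒i-j≤0 (subst (_≤ normSq h) (sym (ℤ.*-identityʳ (+ h node2))) (normSq≥h₂ h))

columnExcess≡0⇒normSq≡ : ∀ s h → columnExcess s h ≡ 0ℤ → normSq h ≡ + h node2 * minℤ 1 s
columnExcess≡0⇒normSq≡ s h excess≡0 = sym (ℤ.i-j≡0⇒i≡j (+ h node2 * minℤ 1 s) (normSq h) excess≡0)

columnExcess-zero : ∀ s h → columnExcess s h ≡ 0ℤ → (∀ a → h a ≡ 0) ⊎ (1 ℕ.≤ s × NonzeroTight h)
columnExcess-zero zero h excess≡0 = vanishing (normSq-tight h (subst (_≤ + h node2) (sym q≡0) (+≤+ z≤n)))
  where
  q≡0 : normSq h ≡ 0ℤ
  q≡0 = trans (columnExcess≡0⇒normSq≡ zero h excess≡0) (ℤ.*-zeroʳ (+ h node2))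
  vanishing : Any (h ≗_) tightColumns → (∀ a → h a ≡ 0) ⊎ (1 ℕ.≤ zero × NonzeroTight h)
  vanishing (here h≗0) = inj₁ h≗0
  vanishing (there tight) =
    case subst (ℕ._≤ 0) (nonzeroTight-node2 tight) (ℤ.drop‿+≤+ (subst (+ h node2 ≤_) q≡0 (normSq≥h₂ h))) of λ ()
columnExcess-zero (suc s) h excess≡0 =
  split (normSq-tight h (ℤ.≤-reflexive (trans (columnExcess≡0⇒normSq≡ (suc s) h excess≡0) (ℤ.*-identityʳ (+ h node2)))))
  where
  split : Any (h ≗_) tightColumns → (∀ a → h a ≡ 0) ⊎ (1 ℕ.≤ suc s × NonzeroTight h)
  split (here h≗0) = inj₁ h≗0
  split (there tight) = inj₂ (s≤s z≤n , tight)

-- Removing the first column of a rigged configuration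

Positive : RiggedPartition → Set
Positive = All (λ row → 1 ℕ.≤ proj₁ row)

BoundedBy : ℕ → RiggedPartition → Set
BoundedBy n = All (λ row → proj₁ row ℕ.≤ n)

Unrigged : RiggedPartition → Set
Unrigged = All (λ row → proj₂ row ≡ 0ℤ)

strip : RiggedPartition → RiggedPartition
strip [] = []
strip ((suc (suc i) , x) ∷ ν) = (suc i , x) ∷ strip ν
strip (_ ∷ ν) = strip ν

stripRC : RC → RC
stripRC ρ a = strip (ρ a)

column : RC → Root
column ρ a = length (ρ a)

strip-positive : ∀ ν → Positive (strip ν)
strip-positive [] = []
strip-positive ((zero , x) ∷ ν) = strip-positive ν
strip-positive ((suc zero , x) ∷ ν) = strip-positive ν
strip-positive ((suc (suc i) , x) ∷ ν) = s≤s z≤n ∷ strip-positive ν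

strip-bounded : ∀ {n} ν → BoundedBy (suc n) ν → BoundedBy n (strip ν)
strip-bounded [] [] = []
strip-bounded ((zero , x) ∷ ν) (_ ∷ b) = strip-bounded ν b
strip-bounded ((suc zero , x) ∷ ν) (_ ∷ b) = strip-bounded ν b
strip-bounded ((suc (suc i) , x) ∷ ν) (s≤s i<n ∷ b) = i<n ∷ strip-bounded ν b

strip-bounded⁻ : ∀ {n} ν → Positive ν → BoundedBy n (strip ν) → BoundedBy (suc n) ν
strip-bounded⁻ [] [] [] = []
strip-bounded⁻ ((suc zero , x) ∷ ν) (_ ∷ p) b = s≤s z≤n ∷ strip-bounded⁻ ν p b
strip-bounded⁻ ((suc (suc i) , x) ∷ ν) (_ ∷ p) (i<n ∷ b) = s≤s i<n ∷ strip-bounded⁻ ν p b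

strip-unrigged : ∀ ν → Unrigged ν → Unrigged (strip ν)
strip-unrigged [] [] = []
strip-unrigged ((zero , x) ∷ ν) (_ ∷ u) = strip-unrigged ν u
strip-unrigged ((suc zero , x) ∷ ν) (_ ∷ u) = strip-unrigged ν u
strip-unrigged ((suc (suc i) , x) ∷ ν) (x≡0 ∷ u) = x≡0 ∷ strip-unrigged ν u

length-strip-≤ : ∀ ν → length (strip ν) ℕ.≤ length ν
length-strip-≤ [] = z≤n
length-strip-≤ ((zero , x) ∷ ν) = ℕ.m≤n⇒m≤1+n (length-strip-≤ ν)
length-strip-≤ ((suc zero , x) ∷ ν) = ℕ.m≤n⇒m≤1+n (length-strip-≤ ν)
length-strip-≤ ((suc (suc i) , x) ∷ ν) = s≤s (length-strip-≤ ν)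

strip≡[]⇒single : ∀ ν → Positive ν → strip ν ≡ [] → All (λ row → proj₁ row ≡ 1) ν
strip≡[]⇒single [] [] _ = []
strip≡[]⇒single ((suc zero , x) ∷ ν) (_ ∷ p) e = refl ∷ strip≡[]⇒single ν p e

strip-Any⁻ : ∀ {j} ν → Any (λ row → proj₁ row ≡ j) (strip ν) → Any (λ row → proj₁ row ≡ suc j) ν
strip-Any⁻ ((zero , x) ∷ ν) i = there (strip-Any⁻ ν i)
strip-Any⁻ ((suc zero , x) ∷ ν) i = there (strip-Any⁻ ν i)
strip-Any⁻ ((suc (suc n) , x) ∷ ν) (here refl) = here refl
strip-Any⁻ ((suc (suc n) , x) ∷ ν) (there i) = there (strip-Any⁻ ν i)

strip≡[]⇒replicate : ∀ ν → Positive ν → Unrigged ν → strip ν ≡ [] → ν ≡ replicate (length ν) (1 , 0ℤ)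
strip≡[]⇒replicate [] [] [] _ = refl
strip≡[]⇒replicate ((suc zero , x) ∷ ν) (_ ∷ p) (refl ∷ u) e = cong (_ ∷_) (strip≡[]⇒replicate ν p u e)

strip≡replicate⇒replicate : ∀ {k x} ν → strip ν ≡ replicate (length ν) (suc k , x) → ν ≡ replicate (length ν) (suc (suc k) , x)
strip≡replicate⇒replicate [] _ = refl
strip≡replicate⇒replicate ((zero , y) ∷ ν) e =
  ⊥-elim (ℕ.<⇒≱ (ℕ.≤-refl) (subst (ℕ._≤ length ν) (trans (cong length e) (length-replicate _)) (length-strip-≤ ν)))
strip≡replicate⇒replicate ((suc zero , y) ∷ ν) e =
  ⊥-elim (ℕ.<⇒≱ (ℕ.≤-refl) (subst (ℕ._≤ length ν) (trans (cong length e) (length-replicate _)) (length-strip-≤ ν)))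
strip≡replicate⇒replicate ((suc (suc i) , y) ∷ ν) e with ∷-injective e
... | refl , strip≡ = cong (_ ∷_) (strip≡replicate⇒replicate ν strip≡)

Σℤ-strip : ∀ (F G : ℕ → ℤ) c → (∀ i → F (suc i) ≡ c + G i) → G 0 ≡ 0ℤ → ∀ ν → Positive ν →
           Σℤ ν (F ∘′ proj₁) ≡ + length ν * c + Σℤ (strip ν) (G ∘′ proj₁)
Σℤ-strip F G c F-suc G0 [] [] = refl
Σℤ-strip F G c F-suc G0 ((suc zero , x) ∷ ν) (_ ∷ p) = begin
  F 1 + Σℤ ν (F ∘′ proj₁)
    ≡⟨ cong₂ _+_ (trans (F-suc 0) (cong (_+_ c) G0)) (Σℤ-strip F G c F-suc G0 ν p) ⟩
  (c + 0ℤ) + (+ length ν * c + Σℤ (strip ν) (G ∘′ proj₁))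
    ≡⟨ rearrange c (+ length ν) (Σℤ (strip ν) (G ∘′ proj₁)) ⟩
  (c + + length ν * c) + Σℤ (strip ν) (G ∘′ proj₁)
    ≡⟨ cong (_+ Σℤ (strip ν) (G ∘′ proj₁)) (sym (ℤ.suc-* (+ length ν) c)) ⟩
  + suc (length ν) * c + Σℤ (strip ν) (G ∘′ proj₁) ∎
  where
  open ≡-Reasoning
  rearrange : ∀ c n r → (c + 0ℤ) + (n * c + r) ≡ (c + n * c) + r
  rearrange = solve-∀
Σℤ-strip F G c F-suc G0 ((suc (suc i) , x) ∷ ν) (_ ∷ p) = begin
  F (suc (suc i)) + Σℤ ν (F ∘′ proj₁)
    ≡⟨ cong₂ _+_ (F-suc (suc i)) (Σℤ-strip F G c F-suc G0 ν p) ⟩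
  (c + G (suc i)) + (+ length ν * c + Σℤ (strip ν) (G ∘′ proj₁))
    ≡⟨ rearrange c (G (suc i)) (+ length ν) (Σℤ (strip ν) (G ∘′ proj₁)) ⟩
  (c + + length ν * c) + (G (suc i) + Σℤ (strip ν) (G ∘′ proj₁))
    ≡⟨ cong (_+ (G (suc i) + Σℤ (strip ν) (G ∘′ proj₁))) (sym (ℤ.suc-* (+ length ν) c)) ⟩
  + suc (length ν) * c + (G (suc i) + Σℤ (strip ν) (G ∘′ proj₁)) ∎
  where
  open ≡-Reasoning
  rearrange : ∀ c g n r → (c + g) + (n * c + r) ≡ (c + n * c) + (g + r)
  rearrange = solve-∀

size-strip : ∀ ν → Positive ν → size ν ≡ + length ν + size (strip ν)
size-strip ν p = trans (Σℤ-strip +_ +_ (+ 1) (λ _ → refl) refl ν p) (cong (_+ size (strip ν)) (ℤ.*-identityʳ (+ length ν)))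

Q-strip : ∀ i ν → Positive ν → Q (suc i) ν ≡ + length ν + Q i (strip ν)
Q-strip i ν p = trans (Σℤ-strip (minℤ (suc i)) (minℤ i) (+ 1) (λ _ → refl) (cong +_ (ℕ.⊓-zeroʳ i)) ν p) (cong (_+ Q i (strip ν)) (ℤ.*-identityʳ (+ length ν)))

Q-zero : ∀ ν → Q 0 ν ≡ 0ℤ
Q-zero ν = trans (Σℤ-cong {xs = ν} (All.tabulate (λ {row} _ → cong +_ (ℕ.⊓-zeroˡ (proj₁ row))))) (Σℤ-zero ν)

Q-one : ∀ ν → Positive ν → Q 1 ν ≡ + length ν
Q-one ν p = trans (Q-strip 0 ν p) (trans (cong (_+_ (+ length ν)) (Q-zero (strip ν))) (ℤ.+-identityʳ (+ length ν)))

Q-bounded : ∀ k ν → BoundedBy k ν → Q k ν ≡ size ν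
Q-bounded k ν b = Σℤ-cong (All.map (λ row≤k → cong +_ (ℕ.m≥n⇒m⊓n≡n row≤k)) b)

bounded0⇒≡[] : ∀ ν → Positive ν → BoundedBy 0 ν → ν ≡ []
bounded0⇒≡[] [] _ _ = refl
bounded0⇒≡[] (row ∷ ν) (0<row ∷ _) (row≤0 ∷ _) = ⊥-elim (ℕ.<⇒≱ 0<row row≤0)

bounded : ∀ (ρ : RC) → Σ ℕ (λ n → ∀ a → BoundedBy n (ρ a))
bounded ρ = maxOver longest (allFin 7) , rows≤
  where
  rowLength : Row → ℕ
  rowLength = proj₁
  longest : I₀ → ℕ
  longest a = maxOver rowLength (ρ a)
  rows≤ : ∀ a → BoundedBy (maxOver longest (allFin 7)) (ρ a)
  rows≤ a = All.tabulate (λ row∈ρa →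
    ℕ.≤-trans (≤-maxOver rowLength (ρ a) row∈ρa) (≤-maxOver longest (allFin 7) (∈-allFin a)))

size-nonneg : ∀ ν → 0ℤ ≤ size ν
size-nonneg ν = Σℤ-nonneg {xs = ν} (All.tabulate (λ _ → +≤+ z≤n))

size≡0⇒≡[] : ∀ ν → Positive ν → size ν ≡ 0ℤ → ν ≡ []
size≡0⇒≡[] ν pos size≡0 = length≡0⇒≡[] ν (ℤ.+-injective (sym (proj₁
  (+-≤-equal {k = + length ν} {l = size (strip ν)} (+≤+ z≤n) (size-nonneg (strip ν)) (trans (sym size≡0) (size-strip ν pos))))))

minℤ-suc : ∀ i s → minℤ (suc i) s ≡ minℤ 1 s + minℤ i (s ℕ.∸ 1)
minℤ-suc i zero = cong +_ (sym (ℕ.⊓-zeroʳ i))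
minℤ-suc i (suc s) = refl

vacancy-zero : ∀ r s ρ a → vacancy r s ρ a 0 ≡ 0ℤ
vacancy-zero r s ρ a = cong₂ _-_
  (trans (cong (δ a r *_) (cong +_ (ℕ.⊓-zeroˡ s))) (ℤ.*-zeroʳ (δ a r)))
  (ΣI-zero (λ b → trans (cong (A a b *_) (Q-zero (ρ b))) (ℤ.*-zeroʳ (A a b))))

vacancy-one : ∀ r s ρ a → (∀ b → Positive (ρ b)) →
              vacancy r s ρ a 1 ≡ δ a r * minℤ 1 s - ΣI (λ b → A a b * + column ρ b)
vacancy-one r s ρ a pos = cong (_-_ (δ a r * minℤ 1 s)) (ΣI-cong (λ b → cong (A a b *_) (Q-one (ρ b) (pos b))))

vacancy-strip : ∀ r s ρ a i → (∀ b → Positive (ρ b)) →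
                vacancy r s ρ a (suc i) ≡ vacancy r s ρ a 1 + vacancy r (s ℕ.∸ 1) (stripRC ρ) a i
vacancy-strip r s ρ a i pos = begin
  δ a r * minℤ (suc i) s - ΣI (λ b → A a b * Q (suc i) (ρ b))
    ≡⟨ cong₂ (λ m q → δ a r * m - q) (minℤ-suc i s) (trans (ΣI-cong split) (Σℤ-+ (allFin 7) first rest)) ⟩
  δ a r * (minℤ 1 s + minℤ i (s ℕ.∸ 1)) - (ΣI first + ΣI rest)
    ≡⟨ rearrange (δ a r) (minℤ 1 s) (minℤ i (s ℕ.∸ 1)) (ΣI first) (ΣI rest) ⟩
  (δ a r * minℤ 1 s - ΣI first) + vacancy r (s ℕ.∸ 1) (stripRC ρ) a i
    ≡⟨ cong (_+ vacancy r (s ℕ.∸ 1) (stripRC ρ) a i) (sym (vacancy-one r s ρ a pos)) ⟩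
  vacancy r s ρ a 1 + vacancy r (s ℕ.∸ 1) (stripRC ρ) a i ∎
  where
  open ≡-Reasoning
  first rest : I₀ → ℤ
  first b = A a b * + column ρ b
  rest b = A a b * Q i (stripRC ρ b)
  split : ∀ b → A a b * Q (suc i) (ρ b) ≡ first b + rest b
  split b = trans (cong (A a b *_) (Q-strip i (ρ b) (pos b))) (ℤ.*-distribˡ-+ (A a b) _ _)
  rearrange : ∀ d m n p q → d * (m + n) - (p + q) ≡ (d * m - p) + (d * n - q)
  rearrange = solve-∀

vacancy-longest : ∀ r {s ρ k} a → k ℕ.≤ s → (∀ b → BoundedBy k (ρ b)) →
                  vacancy r s ρ a k ≡ δ a r * + k - ΣI (λ b → A a b * size (ρ b))
vacancy-longest r a k≤s bounded-k = cong₂ (λ m q → δ a r * m - q) (cong +_ (ℕ.m≤n⇒m⊓n≡m k≤s))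
  (ΣI-cong (λ b → cong (A a b *_) (Q-bounded _ _ (bounded-k b))))

vacancySum : I₀ → ℕ → RC → ℤ
vacancySum r s ρ = ΣI (λ a → Σℤ (ρ a) (λ row → vacancy r s ρ a (proj₁ row)))

vacancySum-strip : ∀ r s ρ → (∀ b → Positive (ρ b)) →
  vacancySum r s ρ ≡ ΣI (λ a → + column ρ a * vacancy r s ρ a 1) + vacancySum r (s ℕ.∸ 1) (stripRC ρ)
vacancySum-strip r s ρ pos = trans (ΣI-cong rows) (Σℤ-+ (allFin 7) (λ a → + column ρ a * vacancy r s ρ a 1)
  (λ a → Σℤ (stripRC ρ a) (λ row → vacancy r (s ℕ.∸ 1) (stripRC ρ) a (proj₁ row))))
  where
  rows : ∀ a → Σℤ (ρ a) (λ row → vacancy r s ρ a (proj₁ row))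
             ≡ + column ρ a * vacancy r s ρ a 1 + Σℤ (stripRC ρ a) (λ row → vacancy r (s ℕ.∸ 1) (stripRC ρ) a (proj₁ row))
  rows a = Σℤ-strip (vacancy r s ρ a) (vacancy r (s ℕ.∸ 1) (stripRC ρ) a) (vacancy r s ρ a 1)
             (λ i → vacancy-strip r s ρ a i pos) (vacancy-zero r (s ℕ.∸ 1) (stripRC ρ) a) (ρ a) (pos a)

firstColumn-identity : ∀ e x₁ x₂ x₃ x₄ x₅ x₆ x₇ → let x = coords x₁ x₂ x₃ x₄ x₅ x₆ x₇ in
  ΣI (λ a → x a * (δ a node2 * e - ΣI (λ b → A a b * x b))) ≡ x node2 * e - cartanForm x
firstColumn-identity = solve 8 (λ e x₁ x₂ x₃ x₄ x₅ x₆ x₇ → let x = coords x₁ x₂ x₃ x₄ x₅ x₆ x₇ in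
  Σₑ (allFin 7) (λ a → x a ⊗ (Κ (δ a node2) ⊗ e ⊕ ⊝ Σₑ (allFin 7) (λ b → Κ (A a b) ⊗ x b)))
  ⊜ (x node2 ⊗ e ⊕ ⊝ cartanFormₑ x)) refl

vacancySum-split : ∀ s ρ → (∀ b → Positive (ρ b)) →
  vacancySum node2 s ρ ≡ columnExcess s (column ρ) + vacancySum node2 (s ℕ.∸ 1) (stripRC ρ)
vacancySum-split s ρ pos = trans (vacancySum-strip node2 s ρ pos) (cong (_+ vacancySum node2 (s ℕ.∸ 1) (stripRC ρ)) (trans
  (ΣI-cong (λ a → cong (+ column ρ a *_) (vacancy-one node2 s ρ a pos)))
  (firstColumn-identity (minℤ 1 s) (x (# 0)) (x (# 1)) (x (# 2)) (x (# 3)) (x (# 4)) (x (# 5)) (x (# 6)))))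
  where
  x : I₀ → ℤ
  x a = + column ρ a

-- Columns P k ρ: reading ρ column by column, it is ν(β⁽¹⁾, …, β⁽ᵏ⁾) with P β⁽ʲ⁾ for every j.
data Columns (P : Root → Set) : ℕ → RC → Set where
  noColumns : ∀ {ρ} → (∀ a → ρ a ≡ []) → Columns P 0 ρ
  addColumn : ∀ {k ρ} → (∀ a → Positive (ρ a)) → P (column ρ) → Columns P k (stripRC ρ) → Columns P (suc k) ρ

module _ {P : Root → Set} where

  Columns-bounded : ∀ {k ρ} → Columns P k ρ → ∀ a → BoundedBy k (ρ a)
  Columns-bounded (noColumns empty) a = subst (BoundedBy 0) (sym (empty a)) []
  Columns-bounded {ρ = ρ} (addColumn pos _ cols) a = strip-bounded⁻ (ρ a) (pos a) (Columns-bounded cols a)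

  Columns-size : ∀ {a c k ρ} → (∀ {h} → P h → h a ≡ c) → Columns P k ρ → size (ρ a) ≡ + k * + c
  Columns-size {a} _ (noColumns empty) = cong size (empty a)
  Columns-size {a} {c} {suc k} {ρ} P⇒c (addColumn pos p cols) = begin
    size (ρ a)                          ≡⟨ size-strip (ρ a) (pos a) ⟩
    + column ρ a + size (stripRC ρ a)   ≡⟨ cong₂ _+_ (cong +_ (P⇒c p)) (Columns-size P⇒c cols) ⟩
    + c + + k * + c                     ≡⟨ sym (ℤ.suc-* (+ k) (+ c)) ⟩
    + suc k * + c                       ∎
    where open ≡-Reasoning

  Columns-longestRow : ∀ {a k ρ} → (∀ {h} → P h → 1 ℕ.≤ h a) → Columns P (suc k) ρ →
                       Any (λ row → proj₁ row ≡ suc k) (ρ a)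
  Columns-longestRow {a} {ρ = ρ} P⇒ (addColumn pos p (noColumns empty)) =
    All-nonempty⇒Any (strip≡[]⇒single (ρ a) (pos a) (empty a)) (P⇒ p)
  Columns-longestRow {a} {ρ = ρ} P⇒ (addColumn pos p cols@(addColumn _ _ _)) =
    strip-Any⁻ (ρ a) (Columns-longestRow P⇒ cols)

  Columns-map : ∀ {Q : Root → Set} {k ρ} → (∀ {h} → P h → Q h) → Columns P k ρ → Columns Q k ρ
  Columns-map P⇒Q (noColumns empty) = noColumns empty
  Columns-map P⇒Q (addColumn pos p cols) = addColumn pos (P⇒Q p) (Columns-map P⇒Q cols)

  Columns-vanishing : ∀ {k ρ} a → ρ a ≡ [] → Columns P k ρ → Columns (λ h → P h × h a ≡ 0) k ρ
  Columns-vanishing a empty-a (noColumns empty) = noColumns empty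
  Columns-vanishing a empty-a (addColumn pos p cols) =
    addColumn pos (p , cong length empty-a) (Columns-vanishing a (cong strip empty-a) cols)

Columns-uniform : ∀ {β k ρ} → Columns (_≗ β) k ρ → (∀ a → Unrigged (ρ a)) → ∀ a → ρ a ≡ νkβ k β a
Columns-uniform (noColumns empty) unrigged a = empty a
Columns-uniform {β} {ρ = ρ} (addColumn pos h≗β (noColumns empty)) unrigged a =
  trans (strip≡[]⇒replicate (ρ a) (pos a) (unrigged a) (empty a)) (cong (λ n → replicate n (1 , 0ℤ)) (h≗β a))
Columns-uniform {β} {suc (suc k)} {ρ} (addColumn pos h≗β cols@(addColumn _ _ _)) unrigged a =
  trans (strip≡replicate⇒replicate (ρ a) (trans (Columns-uniform cols (λ b → strip-unrigged (ρ b) (unrigged b)) a)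
                                                 (cong (λ n → replicate n (suc k , 0ℤ)) (sym (h≗β a)))))
        (cong (λ n → replicate n (suc (suc k) , 0ℤ)) (h≗β a))

-- Highest weight rigged configurations

vacancySum-empty : ∀ r s ρ → (∀ a → ρ a ≡ []) → vacancySum r s ρ ≡ 0ℤ
vacancySum-empty r s ρ empty =
  ΣI-zero (λ a → subst (λ ν → Σℤ ν (λ row → vacancy r s ρ a (proj₁ row)) ≡ 0ℤ) (sym (empty a)) refl)

vacancySum-nonpos : ∀ n s ρ → (∀ a → Positive (ρ a)) → (∀ a → BoundedBy n (ρ a)) → vacancySum node2 s ρ ≤ 0ℤ
vacancySum-nonpos zero s ρ pos bnd = ℤ.≤-reflexive (vacancySum-empty node2 s ρ (λ a → bounded0⇒≡[] (ρ a) (pos a) (bnd a)))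
vacancySum-nonpos (suc n) s ρ pos bnd = subst (_≤ 0ℤ) (sym (vacancySum-split s ρ pos))
  (ℤ.+-mono-≤ {columnExcess s (column ρ)} {0ℤ} {vacancySum node2 (s ℕ.∸ 1) (stripRC ρ)} {0ℤ} (columnExcess-nonpos s (column ρ))
    (vacancySum-nonpos n (s ℕ.∸ 1) (stripRC ρ) (λ a → strip-positive (ρ a)) (λ a → strip-bounded (ρ a) (bnd a))))

vacancySum-zero⇒columns : ∀ n s ρ → (∀ a → Positive (ρ a)) → (∀ a → BoundedBy n (ρ a)) → vacancySum node2 s ρ ≡ 0ℤ →
                          Σ ℕ (λ k → k ℕ.≤ s × Columns NonzeroTight k ρ)
vacancySum-zero⇒columns zero s ρ pos bnd _ = 0 , z≤n , noColumns (λ a → bounded0⇒≡[] (ρ a) (pos a) (bnd a))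
vacancySum-zero⇒columns (suc n) s ρ pos bnd sum≡0 =
  extend s (columnExcess-zero s (column ρ) (proj₁ parts)) (proj₂ parts)
  where
  pos′ : ∀ a → Positive (stripRC ρ a)
  pos′ a = strip-positive (ρ a)
  bnd′ : ∀ a → BoundedBy n (stripRC ρ a)
  bnd′ a = strip-bounded (ρ a) (bnd a)
  parts : columnExcess s (column ρ) ≡ 0ℤ × vacancySum node2 (s ℕ.∸ 1) (stripRC ρ) ≡ 0ℤ
  parts = +-≤-equal {k = 0ℤ} {l = 0ℤ} (columnExcess-nonpos s (column ρ)) (vacancySum-nonpos n (s ℕ.∸ 1) (stripRC ρ) pos′ bnd′)
                    (trans (sym (vacancySum-split s ρ pos)) sum≡0)
  extend : ∀ s → (∀ a → column ρ a ≡ 0) ⊎ (1 ℕ.≤ s × NonzeroTight (column ρ)) →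
           vacancySum node2 (s ℕ.∸ 1) (stripRC ρ) ≡ 0ℤ → Σ ℕ (λ k → k ℕ.≤ s × Columns NonzeroTight k ρ)
  extend s (inj₁ empty-column) _ = 0 , z≤n , noColumns (λ a → length≡0⇒≡[] (ρ a) (empty-column a))
  extend (suc s) (inj₂ (_ , tight)) rest≡0 =
    let k , k≤s , cols = vacancySum-zero⇒columns n s (stripRC ρ) pos′ bnd′ rest≡0
    in suc k , s≤s k≤s , addColumn pos tight cols

αE7-vacancies : ∀ k σ₁ σ₂ σ₃ σ₄ σ₅ σ₆ σ₇ → let σ = coords σ₁ σ₂ σ₃ σ₄ σ₅ σ₆ σ₇ in
  ΣI (λ a → + αE7 a * (δ a node2 * k - ΣI (λ b → A a b * σ b))) ≡ + 2 * k - σ node2 + σ node7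
αE7-vacancies = solve 8 (λ k σ₁ σ₂ σ₃ σ₄ σ₅ σ₆ σ₇ → let σ = coords σ₁ σ₂ σ₃ σ₄ σ₅ σ₆ σ₇ in
  Σₑ (allFin 7) (λ a → Κ (+ αE7 a) ⊗ (Κ (δ a node2) ⊗ k ⊕ ⊝ Σₑ (allFin 7) (λ b → Κ (A a b) ⊗ σ b)))
  ⊜ (Κ (+ 2) ⊗ k ⊕ ⊝ σ node2 ⊕ σ node7)) refl

-- Since α = Λ₂ − Λ₇, Σₐ αₐ p_k⁽ᵃ⁾ = 2k − |ν⁽²⁾| + |ν⁽⁷⁾|.  Every p_k⁽ᵃ⁾ with αₐ > 0 is the vacancy
-- number of a longest row, hence 0, and |ν⁽²⁾| = 2k; so ν⁽⁷⁾ = ∅, which leaves α as the only column.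
columns-α : ∀ {s ρ k} → k ℕ.≤ s → (∀ a → All (λ row → vacancy node2 s ρ a (proj₁ row) ≡ 0ℤ) (ρ a)) →
            Columns NonzeroTight k ρ → Columns (_≗ αE7) k ρ
columns-α _ _ (noColumns empty) = noColumns empty
columns-α {s} {ρ} {suc k} k≤s vacancies≡0 cols@(addColumn pos _ _) =
  Columns-map (λ (tight , h₇≡0) → nonzeroTight-node7 tight h₇≡0)
              (Columns-vanishing node7 (size≡0⇒≡[] (ρ node7) (pos node7) size₇≡0) cols)
  where
  σ : I₀ → ℤ
  σ b = size (ρ b)
  longest-vacancy≡0 : ∀ a → 1 ℕ.≤ αE7 a → vacancy node2 s ρ a (suc k) ≡ 0ℤ
  longest-vacancy≡0 a α≥1 =
    let vacancy≡0 , length≡ = All.lookupAny (vacancies≡0 a) (Columns-longestRow (λ tight → ℕ.≤-trans α≥1 (nonzeroTight-≥α tight a)) cols)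
    in subst (λ i → vacancy node2 s ρ a i ≡ 0ℤ) length≡ vacancy≡0
  size₂ : σ node2 ≡ + suc k * + 2
  size₂ = Columns-size nonzeroTight-node2 cols
  size₇≡0 : σ node7 ≡ 0ℤ
  size₇≡0 = begin
    σ node7                                    ≡⟨ cancel (+ suc k) (σ node7) ⟩
    + 2 * + suc k - + suc k * + 2 + σ node7    ≡⟨ cong (λ t → + 2 * + suc k - t + σ node7) (sym size₂) ⟩
    + 2 * + suc k - σ node2 + σ node7          ≡⟨ sym (αE7-vacancies (+ suc k) (σ (# 0)) (σ (# 1)) (σ (# 2)) (σ (# 3)) (σ (# 4)) (σ (# 5)) (σ (# 6))) ⟩
    ΣI (λ a → + αE7 a * (δ a node2 * + suc k - ΣI (λ b → A a b * σ b)))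
      ≡⟨ ΣI-zero (λ a → *-vanishing (αE7 a) (λ α≥1 → trans (sym (vacancy-longest node2 a k≤s (Columns-bounded cols))) (longest-vacancy≡0 a α≥1))) ⟩
    0ℤ                                         ∎
    where
    open ≡-Reasoning
    cancel : ∀ k t → t ≡ + 2 * k - k * + 2 + t
    cancel = solve-∀

module _ {s ρ} (hw : IsHWRC node2 s ρ) where

  private
    isRC : IsRC node2 s ρ
    isRC = proj₁ hw
    riggings≥0 : ∀ a → All (λ row → 0ℤ ≤ proj₂ row) (ρ a)
    riggings≥0 = proj₂ hw

  highestWeight-positive : ∀ a → Positive (ρ a)
  highestWeight-positive a = All.map proj₁ (isRC a)

  highestWeight-vacancies≥0 : ∀ a → All (λ row → 0ℤ ≤ vacancy node2 s ρ a (proj₁ row)) (ρ a)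
  highestWeight-vacancies≥0 a = All.zipWith (λ (fits , rigging≥0) → ℤ.≤-trans rigging≥0 (proj₂ fits)) (isRC a , riggings≥0 a)

  highestWeight-rowSums≥0 : All (λ a → 0ℤ ≤ Σℤ (ρ a) (λ row → vacancy node2 s ρ a (proj₁ row))) (allFin 7)
  highestWeight-rowSums≥0 = All.tabulate (λ {a} _ → Σℤ-nonneg (highestWeight-vacancies≥0 a))

  highestWeight-vacancySum≡0 : vacancySum node2 s ρ ≡ 0ℤ
  highestWeight-vacancySum≡0 = ℤ.≤-antisym
    (vacancySum-nonpos (proj₁ (bounded ρ)) s ρ highestWeight-positive (proj₂ (bounded ρ)))
    (Σℤ-nonneg highestWeight-rowSums≥0)

  highestWeight-vacancies≡0 : ∀ a → All (λ row → vacancy node2 s ρ a (proj₁ row) ≡ 0ℤ) (ρ a)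
  highestWeight-vacancies≡0 a = Σℤ-nonneg-zero (highestWeight-vacancies≥0 a)
    (All.lookup (Σℤ-nonneg-zero highestWeight-rowSums≥0 highestWeight-vacancySum≡0) (∈-allFin a))

  highestWeight-unrigged : ∀ a → Unrigged (ρ a)
  highestWeight-unrigged a = All.zipWith
    (λ ((fits , rigging≥0) , vacancy≡0) → ℤ.≤-antisym (subst (_ ≤_) vacancy≡0 (proj₂ fits)) rigging≥0)
    (All.zipWith id (isRC a , riggings≥0 a) , highestWeight-vacancies≡0 a)

highestWeight-unique : ∀ s ρ → IsHWRC node2 s ρ → Σ ℕ (λ k → k ℕ.≤ s × ρ ≈RC νkβ k αE7)
highestWeight-unique s ρ hw =
  let k , k≤s , cols = vacancySum-zero⇒columns (proj₁ (bounded ρ)) s ρ (highestWeight-positive hw) (proj₂ (bounded ρ))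
                         (highestWeight-vacancySum≡0 hw)
      uniform = Columns-uniform (columns-α k≤s (highestWeight-vacancies≡0 hw) cols) (highestWeight-unrigged hw)
  in k , k≤s , λ a → ↭-reflexive (uniform a)

-- The configurations ν(k ∗ [β])

Q-νkβ : ∀ i k β b → Q i (νkβ k β b) ≡ + β b * minℤ i k
Q-νkβ i zero β b = sym (trans (cong (λ m → + β b * + m) (ℕ.⊓-zeroʳ i)) (ℤ.*-zeroʳ (+ β b)))
Q-νkβ i (suc k) β b = Σℤ-replicate (β b) (suc k , 0ℤ) (λ row → minℤ i (proj₁ row))

size-νkβ : ∀ k β b → size (νkβ k β b) ≡ + β b * + k
size-νkβ zero β b = sym (ℤ.*-zeroʳ (+ β b))
size-νkβ (suc k) β b = Σℤ-replicate (β b) (suc k , 0ℤ) (λ row → + proj₁ row)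

riggingSum-νkβ : ∀ k β → riggingSum (νkβ k β) ≡ 0ℤ
riggingSum-νkβ zero β = ΣI-zero (λ _ → refl)
riggingSum-νkβ (suc k) β = ΣI-zero (λ a → trans (Σℤ-replicate (β a) (suc k , 0ℤ) proj₂) (ℤ.*-zeroʳ (+ β a)))

quadratic-νkβ : ∀ k β → quadratic (νkβ (suc k) β) ≡ ΣI (λ a → ΣI (λ b → A a b * (+ β a * (+ β b * + suc k))))
quadratic-νkβ k β = ΣI-cong (λ a → ΣI-cong (λ b → cong (A a b *_) (trans
  (Σℤ-replicate {Row} (β a) (suc k , 0ℤ) (λ row → Σℤ (νkβ (suc k) β b) (λ row′ → minℤ (proj₁ row) (proj₁ row′))))
  (cong (+ β a *_) (trans (Q-νkβ (suc k) (suc k) β b) (cong (λ m → + β b * + m) (ℕ.⊓-idem (suc k))))))))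

vacancy-νkβ : ∀ r s k β a i → vacancy r s (νkβ k β) a i ≡ δ a r * minℤ i s - ΣI (λ b → A a b * + β b) * minℤ i k
vacancy-νkβ r s k β a i = cong (_-_ (δ a r * minℤ i s)) (trans
  (ΣI-cong (λ b → trans (cong (A a b *_) (Q-νkβ i k β b)) (sym (ℤ.*-assoc (A a b) (+ β b) (minℤ i k)))))
  (Σℤ-*ʳ (allFin 7) (λ b → A a b * + β b) (minℤ i k)))

weight-νkβ : ∀ r s k β b → weight r s (νkβ k β) b ≡ + s * δ b r - + k * ΣI (λ a → + β a * A a b)
weight-νkβ r s k β b = cong (_-_ (+ s * δ b r)) (trans
  (ΣI-cong (λ a → trans (cong (_* A a b) (size-νkβ k β a)) (reorder (+ β a) (+ k) (A a b))))
  (Σℤ-*ˡ (allFin 7) (+ k) (λ a → + β a * A a b)))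
  where
  reorder : ∀ x y z → x * y * z ≡ y * (x * z)
  reorder = solve-∀

αE7-cartan : ∀ a → ΣI (λ b → A a b * + αE7 b) ≡ δ a node2 - δ a node7
αE7-cartan = toWitness {a? = all? (λ a → ΣI (λ b → A a b * + αE7 b) ℤ.≟ δ a node2 - δ a node7)} _

αE7-cartanᵀ : ∀ b → ΣI (λ a → + αE7 a * A a b) ≡ δ b node2 - δ b node7
αE7-cartanᵀ = toWitness {a? = all? (λ b → ΣI (λ a → + αE7 a * A a b) ℤ.≟ δ b node2 - δ b node7)} _

αE7-norm : ∀ k → ΣI (λ a → ΣI (λ b → A a b * (+ αE7 a * (+ αE7 b * k)))) ≡ + 2 * k
αE7-norm = solve 1 (λ k → Σₑ (allFin 7) (λ a → Σₑ (allFin 7) (λ b → Κ (A a b) ⊗ (Κ (+ αE7 a) ⊗ (Κ (+ αE7 b) ⊗ k))))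
                          ⊜ Κ (+ 2) ⊗ k) refl

δ*-nonneg : ∀ a b k → 0ℤ ≤ δ a b * + k
δ*-nonneg a b k = indicator-nonneg (label a ℕ.≡ᵇ label b)
  where
  indicator-nonneg : ∀ c → 0ℤ ≤ (if c then + 1 else 0ℤ) * + k
  indicator-nonneg true = subst (0ℤ ≤_) (sym (ℤ.*-identityˡ (+ k))) (+≤+ z≤n)
  indicator-nonneg false = ℤ.≤-refl

νkα-vacancy : ∀ {s k} a → k ℕ.≤ s → vacancy node2 s (νkβ k αE7) a k ≡ δ a node7 * + k
νkα-vacancy {s} {k} a k≤s = begin
  vacancy node2 s (νkβ k αE7) a k
    ≡⟨ vacancy-νkβ node2 s k αE7 a k ⟩
  δ a node2 * minℤ k s - ΣI (λ b → A a b * + αE7 b) * minℤ k k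
    ≡⟨ cong₂ (λ m c → δ a node2 * + m - c * + (k ℕ.⊓ k)) (ℕ.m≤n⇒m⊓n≡m k≤s) (αE7-cartan a) ⟩
  δ a node2 * + k - (δ a node2 - δ a node7) * + (k ℕ.⊓ k)
    ≡⟨ cong (λ m → δ a node2 * + k - (δ a node2 - δ a node7) * + m) (ℕ.⊓-idem k) ⟩
  δ a node2 * + k - (δ a node2 - δ a node7) * + k
    ≡⟨ simplify (δ a node2) (δ a node7) (+ k) ⟩
  δ a node7 * + k ∎
  where
  open ≡-Reasoning
  simplify : ∀ d₂ d₇ k → d₂ * k - (d₂ - d₇) * k ≡ d₇ * k
  simplify = solve-∀

νkα-highestWeight : ∀ {s k} → k ℕ.≤ s → IsHWRC node2 s (νkβ k αE7)
νkα-highestWeight {k = zero} _ = (λ _ → []) , (λ _ → [])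
νkα-highestWeight {s} {suc k} k≤s =
  (λ a → replicate⁺ (αE7 a) (s≤s z≤n , subst (0ℤ ≤_) (sym (νkα-vacancy a k≤s)) (δ*-nonneg a node7 (suc k)))) ,
  (λ a → replicate⁺ (αE7 a) ℤ.≤-refl)

νkα-weight : ∀ {s k} → k ℕ.≤ s → ∀ b → weight node2 s (νkβ k αE7) b ≡ targetWeight s k b
νkα-weight {s} {k} k≤s b = begin
  weight node2 s (νkβ k αE7) b                    ≡⟨ weight-νkβ node2 s k αE7 b ⟩
  + s * δ b node2 - + k * ΣI (λ a → + αE7 a * A a b)
    ≡⟨ cong₂ (λ t w → t * δ b node2 - + k * w) s≡ (αE7-cartanᵀ b) ⟩
  (+ (s ℕ.∸ k) + + k) * δ b node2 - + k * (δ b node2 - δ b node7)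
    ≡⟨ simplify (+ (s ℕ.∸ k)) (+ k) (δ b node2) (δ b node7) ⟩
  targetWeight s k b                              ∎
  where
  open ≡-Reasoning
  s≡ : + s ≡ + (s ℕ.∸ k) + + k
  s≡ = cong +_ (sym (ℕ.m∸n+n≡m k≤s))
  simplify : ∀ t k d₂ d₇ → (t + k) * d₂ - k * (d₂ - d₇) ≡ t * d₂ + k * d₇
  simplify = solve-∀

νkα-cocharge : ∀ k → cocharge (νkβ k αE7) ≡ + k
νkα-cocharge zero = refl
νkα-cocharge (suc k) = begin
  quadratic (νkβ (suc k) αE7) /ℕ 2 + riggingSum (νkβ (suc k) αE7)
    ≡⟨ cong₂ (λ q r → q /ℕ 2 + r) (trans (quadratic-νkβ k αE7) (αE7-norm (+ suc k))) (riggingSum-νkβ (suc k) αE7) ⟩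
  + 2 * + suc k /ℕ 2 + 0ℤ
    ≡⟨ cong (λ q → q /ℕ 2 + 0ℤ) (sym (ℤ.pos-* 2 (suc k))) ⟩
  + (2 ℕ.* suc k ℕ./ 2) + 0ℤ
    ≡⟨ cong (λ n → + n + 0ℤ) (trans (cong (ℕ._/ 2) (ℕ.*-comm 2 (suc k))) (ℕ.m*n/n≡m (suc k) 2)) ⟩
  + suc k + 0ℤ
    ≡⟨ ℤ.+-identityʳ (+ suc k) ⟩
  + suc k ∎
  where open ≡-Reasoning

proposition9p16 : (s : ℕ) → 1 ℕ.≤ s →
    ((ρ : RC) → IsHWRC node2 s ρ → Σ ℕ (λ k → k ℕ.≤ s × ρ ≈RC νkβ k αE7))
    × ((k : ℕ) → k ℕ.≤ s →
        IsHWRC node2 s (νkβ k αE7)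
        × ((b : I₀) → weight node2 s (νkβ k αE7) b ≡ targetWeight s k b)
        × cocharge (νkβ k αE7) ≡ + k)
proposition9p16 s _ =
  highestWeight-unique s , λ k k≤s → νkα-highestWeight k≤s , νkα-weight k≤s , νkα-cocharge k
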